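{- Let $n\ge1$, $f:\{0,1\}^n\to\{0,1\}$, let $I\subseteq f^{ -1}(1)$ be a nonempty set of YES inputs of $f$, and let $S>0$. Suppose there is an assignment rule which, to every branching program $G$ on $n$ variables and every vertex $v$ of $G$, associates a set $A(G,v)\subseteq I$ (the inputs to which $v$ "can be assigned"), such that: (1) for every branching program $G$, every $x\in I$ and every path in $G$ from a start node to an accept node which follows input $x$ (i.e. every edge on it has a label agreeing with $x$), there is a vertex $v_x$ on this path with $x\in A(G,v_x)$; (2) for every branching program $G$ which computes $f$ $m'$ times for some $m'\ge1$ and every vertex $v$ of $G$, $|A(G,v)|\le \frac{|I|}{S}$. Then for every $m\ge 1$, $b_m(f)\ge mS$.
   Context: A branching program on variables $x_1,\dots,x_n$ is a finite directed acyclic multigraph $G$ with labeled edges and distinguished sets of start nodes, accept nodes and reject nodes such that: every vertex has outdegree $0$ or $2$; for each vertex of outdegree $2$ there is an $i\in[1,n]$ such that one outgoing edge is labeled $x_i=0$ and the other is labeled $x_i=1$; every vertex of outdegree $0$ is an accept node or a reject node. On input $x\in\{0,1\}^n$, starting from a start node $s$, one follows the unique path whose edge labels agree with $x$ until reaching a vertex of outdegree $0$. The size of $G$ is $|V(G)|$. A branching program computes $f$ $m$ times if it has $m$ start nodes $s_1,\dots,s_m$, $m$ accept nodes $a_1,\dots,a_m$ and $m$ reject nodes $r_1,\dots,r_m$, and for every $i$ and every input $x$, the computation starting at $s_i$ on input $x$ ends at $a_i$ if $f(x)=1$ and at $r_i$ if $f(x)=0$. $b_m(f)$ denotes the minimum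 size of a branching program computing $f$ $m$ times.
   Formalization: The parameter S ranges over the positive rationals. -}

module Defs where

open import Data.Nat using (ℕ)
open import Data.Bool using (Bool; true; false; if_then_else_)
open import Data.Fin using (Fin; _<_)
open import Data.Fin.Subset using (Subset; _∈_)
open import Data.Vec using (Vec; lookup)
open import Data.List using (List; []; _∷_)
open import Data.Product using (_×_; ∃)
open import Data.Integer using (+_)
open import Data.Rational using (ℚ; _/_)
open import Relation.Binary.PropositionalEquality using (_≡_)
open import Function.Definitions using (Injective)

Input : ℕ → Set
Input n = Vec Bool n

-- A vertex of a branching program with vertex set Fin N on n variables:
-- either a sink (outdegree 0) labelled accept (true) or reject (false),
-- or a query vertex labelled by variable i, with an edge labelled x_i=0
-- going to the first successor and an edge labelled x_i=1 going to the
-- second successor (multi-edges allowed: both successors may coincide).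
data Node (n N : ℕ) : Set where
  sink  : Bool → Node n N
  query : Fin n → Fin N → Fin N → Node n N

-- Acyclicity is expressed by a topological
-- numbering of the vertices: every edge goes from a smaller to a larger
-- vertex (every finite DAG is isomorphic to one of this form).
record BP (n : ℕ) : Set where
  field
    size    : ℕ
    node    : Fin size → Node n size
    start   : Subset size
    ordered : ∀ {v i l r} → node v ≡ query i l r → (v < l) × (v < r)

open BP public

IsAccept : ∀ {n} (G : BP n) → Fin (size G) → Set
IsAccept G v = node G v ≡ sink true

IsReject : ∀ {n} (G : BP n) → Fin (size G) → Set
IsReject G v = node G v ≡ sink false

data Path {n} (G : BP n) (x : Input n) : Fin (size G) → Fin (size G) → Set where
  stop : ∀ v → Path G x v v
  step : ∀ {u w i l r} → node G u ≡ query i l r →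
         Path G x (if lookup x i then r else l) w → Path G x u w

verts : ∀ {n} {G : BP n} {x : Input n} {u w} → Path G x u w → List (Fin (size G))
verts (stop v) = v ∷ []
verts (step {u = u} _ p) = u ∷ verts p

record Computes {n} (G : BP n) (f : Input n → Bool) (m : ℕ) : Set where
  field
    s a r     : Fin m → Fin (size G)
    s-inj     : Injective _≡_ _≡_ s
    a-inj     : Injective _≡_ _≡_ a
    r-inj     : Injective _≡_ _≡_ r
    start-s   : ∀ v → v ∈ start G → ∃ λ j → s j ≡ v
    s-start   : ∀ j → s j ∈ start G
    accept-a  : ∀ v → IsAccept G v → ∃ λ j → a j ≡ v
    a-accept  : ∀ j → IsAccept G (a j)
    reject-r  : ∀ v → IsReject G v → ∃ λ j → r j ≡ v
    r-reject  : ∀ j → IsReject G (r j)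
    -- the computation from s_j on x ends at a_j if f x = 1, at r_j if f x = 0
    -- (a_j, r_j are sinks, so the path following x from s_j ends there)
    correct-1 : ∀ j x → f x ≡ true  → Path G x (s j) (a j)
    correct-0 : ∀ j x → f x ≡ false → Path G x (s j) (r j)

ℕtoℚ : ℕ → ℚ
ℕtoℚ k = (+ k) / 1

-- Fix a YES input I j.  In a program computing f m times, its m accepting computations are
-- pairwise vertex-disjoint (a shared vertex would force the same sink, and the accept nodes are
-- distinct), and each of them contains a vertex to which I j is assigned; so I j is assigned to at
-- least m vertices.  Double counting the pairs (vertex, input assigned to it) gives
-- k m ≤ Σ_v |A(G,v)| ≤ |G| k / S.

module Submission where

open import Defs
open import Data.Nat using (ℕ; _≤_)
open import Data.Bool using (Bool; true; false)
open import Data.Fin using (Fin)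
open import Data.Fin.Subset using (Subset; _∈_; ∣_∣)
open import Data.List.Membership.Propositional using () renaming (_∈_ to _∈ₗ_)
open import Data.Product using (_×_; ∃)
open import Data.Rational using (ℚ; 0ℚ; _*_) renaming (_≤_ to _≤ℚ_; _<_ to _<ℚ_)
open import Relation.Binary.PropositionalEquality using (_≡_)
open import Function.Definitions using (Injective)

open import Data.Nat as ℕ using (zero; suc; z≤n; s≤s; _<_)
import Data.Nat.Properties as ℕP
open import Data.Fin as Fin using (fromℕ<)
import Data.Fin.Properties as FinP
open import Data.Fin.Subset using (inside; outside)
open import Data.Vec using ([]; _∷_; lookup; tabulate; here; there)
import Data.Vec.Properties as VecP
import Data.List.Relation.Unary.Any as Any
open import Data.Product using (_,_; proj₁; proj₂)
import Data.Integer as ℤ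
open import Data.Integer using (+_)
import Data.Integer.Properties as ℤP
import Data.Rational as ℚ
import Data.Rational.Properties as ℚP
open import Data.Nat.Coprimality using (1-coprimeTo) renaming (sym to coprime-sym)
open import Relation.Binary.PropositionalEquality using (refl; sym; trans; cong; cong₂; subst; subst₂; module ≡-Reasoning)
open import Algebra.Properties.CommutativeMonoid.Sum ℕP.+-0-commutativeMonoid
  using (sum; sum-syntax; sum-cong-≗; ∑-comm)

ℕtoℚ-mkℚ : ∀ a → ℕtoℚ a ≡ ℚ.mkℚ (+ a) 0 (coprime-sym (1-coprimeTo a))
ℕtoℚ-mkℚ a = ℚP.normalize-coprime (coprime-sym (1-coprimeTo a))

ℕtoℚ-+ : ∀ a b → ℕtoℚ (a ℕ.+ b) ≡ ℕtoℚ a ℚ.+ ℕtoℚ b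
ℕtoℚ-+ a b rewrite ℕtoℚ-mkℚ a | ℕtoℚ-mkℚ b =
  cong (ℚ._/ 1) (cong₂ ℤ._+_ (sym (ℤP.*-identityʳ (+ a))) (sym (ℤP.*-identityʳ (+ b))))

ℕtoℚ-* : ∀ a b → ℕtoℚ (a ℕ.* b) ≡ ℕtoℚ a * ℕtoℚ b
ℕtoℚ-* a b rewrite ℕtoℚ-mkℚ a | ℕtoℚ-mkℚ b = cong (ℚ._/ 1) (ℤP.pos-* a b)

ℕtoℚ-mono-≤ : ∀ {a b} → a ≤ b → ℕtoℚ a ≤ℚ ℕtoℚ b
ℕtoℚ-mono-≤ {a} {b} a≤b rewrite ℕtoℚ-mkℚ a | ℕtoℚ-mkℚ b =
  ℚ.*≤* (subst₂ ℤ._≤_ (sym (ℤP.*-identityʳ (+ a))) (sym (ℤP.*-identityʳ (+ b))) (ℤ.+≤+ a≤b))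

ℕtoℚ-suc-positive : ∀ a → ℚ.Positive (ℕtoℚ (suc a))
ℕtoℚ-suc-positive a rewrite ℕtoℚ-mkℚ (suc a) = _

∑-const : ∀ k a → ∑[ i < k ] a ≡ k ℕ.* a
∑-const zero    a = refl
∑-const (suc k) a = cong (a ℕ.+_) (∑-const k a)

∑-mono-≤ : ∀ {N} {c d : Fin N → ℕ} → (∀ i → c i ≤ d i) → sum c ≤ sum d
∑-mono-≤ {zero}  c≤d = z≤n
∑-mono-≤ {suc N} c≤d = ℕP.+-mono-≤ (c≤d Fin.zero) (∑-mono-≤ (λ i → c≤d (Fin.suc i)))

∑-bound : ∀ {N} (c : Fin N → ℕ) (S K : ℚ) .{{_ : ℚ.NonNegative S}} →
          (∀ i → ℕtoℚ (c i) * S ≤ℚ K) → ℕtoℚ (sum c) * S ≤ℚ ℕtoℚ N * K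
∑-bound {zero}  c S K _   = ℚP.≤-reflexive (trans (ℚP.*-zeroˡ S) (sym (ℚP.*-zeroˡ K)))
∑-bound {suc N} c S K c≤ = begin
  ℕtoℚ (c Fin.zero ℕ.+ sum c′) * S            ≡⟨ cong (_* S) (ℕtoℚ-+ (c Fin.zero) (sum c′)) ⟩
  (ℕtoℚ (c Fin.zero) ℚ.+ ℕtoℚ (sum c′)) * S   ≡⟨ ℚP.*-distribʳ-+ S (ℕtoℚ (c Fin.zero)) (ℕtoℚ (sum c′)) ⟩
  ℕtoℚ (c Fin.zero) * S ℚ.+ ℕtoℚ (sum c′) * S ≤⟨ ℚP.+-mono-≤ (c≤ Fin.zero) (∑-bound c′ S K (λ i → c≤ (Fin.suc i))) ⟩
  K ℚ.+ ℕtoℚ N * K                            ≡⟨ cong (ℚ._+ ℕtoℚ N * K) (sym (ℚP.*-identityˡ K)) ⟩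
  ℚ.1ℚ * K ℚ.+ ℕtoℚ N * K                     ≡⟨ sym (ℚP.*-distribʳ-+ K ℚ.1ℚ (ℕtoℚ N)) ⟩
  (ℚ.1ℚ ℚ.+ ℕtoℚ N) * K                       ≡⟨ cong (_* K) (sym (ℕtoℚ-+ 1 N)) ⟩
  ℕtoℚ (suc N) * K                            ∎
  where
  open ℚP.≤-Reasoning
  c′ = λ i → c (Fin.suc i)

indicator : Bool → ℕ
indicator true  = 1
indicator false = 0

∣p∣≡∑indicator : ∀ {N} (p : Subset N) → ∣ p ∣ ≡ ∑[ i < N ] indicator (lookup p i)
∣p∣≡∑indicator []            = refl
∣p∣≡∑indicator (inside  ∷ p) = cong suc (∣p∣≡∑indicator p)
∣p∣≡∑indicator (outside ∷ p) = ∣p∣≡∑indicator p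

rank : ∀ {N} → Subset N → Fin N → ℕ
rank (_       ∷ p) Fin.zero    = 0
rank (inside  ∷ p) (Fin.suc v) = suc (rank p v)
rank (outside ∷ p) (Fin.suc v) = rank p v

rank<∣p∣ : ∀ {N} {p : Subset N} {v} → v ∈ p → rank p v < ∣ p ∣
rank<∣p∣ here                           = s≤s z≤n
rank<∣p∣ {p = inside  ∷ p} (there v∈p) = s≤s (rank<∣p∣ v∈p)
rank<∣p∣ {p = outside ∷ p} (there v∈p) = rank<∣p∣ v∈p

rank-injective : ∀ {N} {p : Subset N} {u v} → u ∈ p → v ∈ p → rank p u ≡ rank p v → u ≡ v
rank-injective here        here        _  = refl
rank-injective {p = inside ∷ _} here (there _) ()
rank-injective {p = inside ∷ _} (there _) here ()
rank-injective {p = inside  ∷ p} (there u∈p) (there v∈p) eq =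
  cong Fin.suc (rank-injective u∈p v∈p (ℕP.suc-injective eq))
rank-injective {p = outside ∷ p} (there u∈p) (there v∈p) eq =
  cong Fin.suc (rank-injective u∈p v∈p eq)

injective⇒≤∣p∣ : ∀ {m N} {p : Subset N} (g : Fin m → Fin N) →
                 Injective _≡_ _≡_ g → (∀ i → g i ∈ p) → m ≤ ∣ p ∣
injective⇒≤∣p∣ {m} {p = p} g g-inj g∈p = FinP.injective⇒≤ {f = position} position-injective
  where
  position : Fin m → Fin ∣ p ∣
  position i = fromℕ< (rank<∣p∣ (g∈p i))
  position-injective : Injective _≡_ _≡_ position
  position-injective {i} {i′} eq = g-inj (rank-injective (g∈p i) (g∈p i′) (begin
    rank p (g i)          ≡⟨ sym (FinP.toℕ-fromℕ< (rank<∣p∣ (g∈p i))) ⟩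
    Fin.toℕ (position i)  ≡⟨ cong Fin.toℕ eq ⟩
    Fin.toℕ (position i′) ≡⟨ FinP.toℕ-fromℕ< (rank<∣p∣ (g∈p i′)) ⟩
    rank p (g i′)         ∎))
    where open ≡-Reasoning

column : ∀ {N k} → (Fin N → Subset k) → Fin k → Subset N
column A j = tabulate (λ v → lookup (A v) j)

∈-column : ∀ {N k} (A : Fin N → Subset k) {v j} → j ∈ A v → v ∈ column A j
∈-column A {v} {j} j∈Av = VecP.lookup⇒[]= v _ (trans (VecP.lookup∘tabulate _ v) (VecP.[]=⇒lookup j∈Av))

∑∣row∣≡∑∣column∣ : ∀ {N k} (A : Fin N → Subset k) →
                   ∑[ v < N ] ∣ A v ∣ ≡ ∑[ j < k ] ∣ column A j ∣
∑∣row∣≡∑∣column∣ {N} {k} A = begin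
  ∑[ v < N ] ∣ A v ∣                                         ≡⟨ sum-cong-≗ (λ v → ∣p∣≡∑indicator (A v)) ⟩
  ∑[ v < N ] ∑[ j < k ] indicator (lookup (A v) j)           ≡⟨ ∑-comm (λ v j → indicator (lookup (A v) j)) ⟩
  ∑[ j < k ] ∑[ v < N ] indicator (lookup (A v) j)           ≡⟨ sum-cong-≗ (λ j → sum-cong-≗ (λ v →
                                                                cong indicator (lookup-column j v))) ⟩
  ∑[ j < k ] ∑[ v < N ] indicator (lookup (column A j) v)    ≡⟨ sum-cong-≗ (λ j → sym (∣p∣≡∑indicator (column A j))) ⟩
  ∑[ j < k ] ∣ column A j ∣                                  ∎
  where
  open ≡-Reasoning
  lookup-column : ∀ j v → lookup (A v) j ≡ lookup (column A j) v
  lookup-column j v = sym (VecP.lookup∘tabulate (λ u → lookup (A u) j) v)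

module _ {n} {G : BP n} {x : Input n} where

  Path-from-sink : ∀ {u w b} → node G u ≡ sink b → Path G x u w → u ≡ w
  Path-from-sink _      (stop _)         = refl
  Path-from-sink u-sink (step u-query _) with trans (sym u-sink) u-query
  ... | ()

  Path-to-sink-unique : ∀ {u w w′ b b′} → node G w ≡ sink b → node G w′ ≡ sink b′ →
                        Path G x u w → Path G x u w′ → w ≡ w′
  Path-to-sink-unique w-sink _       (stop _)         q        = Path-from-sink w-sink q
  Path-to-sink-unique _      w′-sink (step u-query _) (stop _) with trans (sym u-query) w′-sink
  ... | ()
  Path-to-sink-unique w-sink w′-sink (step u-query p) (step u-query′ q) with trans (sym u-query) u-query′
  ... | refl = Path-to-sink-unique w-sink w′-sink p q

  Path-suffix : ∀ {u w v} (p : Path G x u w) → v ∈ₗ verts p → Path G x v w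
  Path-suffix (stop _)   (Any.here refl)  = stop _
  Path-suffix (step e p) (Any.here refl)  = step e p
  Path-suffix (step _ p) (Any.there v∈p) = Path-suffix p v∈p

-- The m accepting computations on x are vertex-disjoint: from a shared vertex both would reach
-- the same sink, but they end at distinct accept nodes.
hitting-set-size : ∀ {n} {G : BP n} {f m} (C : Computes G f m) {x} → f x ≡ true → (P : Subset (size G)) →
  (∀ {s w} → s ∈ start G → IsAccept G w → (p : Path G x s w) → ∃ λ v → v ∈ₗ verts p × v ∈ P) →
  m ≤ ∣ P ∣
hitting-set-size {G = G} {m = m} C {x} fx P hits = injective⇒≤∣p∣ hit hit-injective (λ i → proj₂ (proj₂ (hits′ i)))
  where
  open Computes C
  computation : ∀ i → Path G x (s i) (a i)
  computation i = correct-1 i x fx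
  hits′ : ∀ i → ∃ λ v → v ∈ₗ verts (computation i) × v ∈ P
  hits′ i = hits (s-start i) (a-accept i) (computation i)
  hit : Fin m → Fin (size G)
  hit i = proj₁ (hits′ i)
  from-hit : ∀ i → Path G x (hit i) (a i)
  from-hit i = Path-suffix (computation i) (proj₁ (proj₂ (hits′ i)))
  hit-injective : Injective _≡_ _≡_ hit
  hit-injective {i} {i′} eq = a-inj (Path-to-sink-unique (a-accept i) (a-accept i′)
    (from-hit i) (subst (λ v → Path G x v (a i′)) (sym eq) (from-hit i′)))

total-assignment-≥ : ∀ {n} {G : BP n} {f m k} → Computes G f m →
  (I : Fin k → Input n) → (∀ j → f (I j) ≡ true) → (A : Fin (size G) → Subset k) →
  (∀ j {s w} → s ∈ start G → IsAccept G w → (p : Path G (I j) s w) → ∃ λ v → v ∈ₗ verts p × j ∈ A v) →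
  k ℕ.* m ≤ ∑[ v < size G ] ∣ A v ∣
total-assignment-≥ {G = G} {m = m} {k} C I fI A assigned = begin
  k ℕ.* m                     ≡⟨ sym (∑-const k m) ⟩
  ∑[ j < k ] m                ≤⟨ ∑-mono-≤ column-size ⟩
  ∑[ j < k ] ∣ column A j ∣   ≡⟨ sym (∑∣row∣≡∑∣column∣ A) ⟩
  ∑[ v < size G ] ∣ A v ∣     ∎
  where
  open ℕP.≤-Reasoning
  column-size : ∀ j → m ≤ ∣ column A j ∣
  column-size j = hitting-set-size C (fI j) (column A j) λ s∈ w-acc p →
    let v , v∈p , j∈Av = assigned j s∈ w-acc p in v , v∈p , ∈-column A j∈Av

mainTheorem3 : (n : ℕ) → 1 ≤ n → (f : Input n → Bool) →
    (k : ℕ) → (I : Fin k → Input n) → Injective _≡_ _≡_ I → 1 ≤ k →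
    (∀ j → f (I j) ≡ true) →
    (S : ℚ) → 0ℚ <ℚ S →
    (A : (G : BP n) → Fin (size G) → Subset k) →
    (∀ (G : BP n) (j : Fin k) {s w : Fin (size G)} → s ∈ start G → IsAccept G w →
       (p : Path G (I j) s w) → ∃ λ v → (v ∈ₗ verts p) × (j ∈ A G v)) →
    (∀ (G : BP n) (m′ : ℕ) → 1 ≤ m′ → Computes G f m′ →
       ∀ v → ℕtoℚ ∣ A G v ∣ * S ≤ℚ ℕtoℚ k) →
    ∀ (m : ℕ) → 1 ≤ m → ∀ (G : BP n) → Computes G f m →
      ℕtoℚ m * S ≤ℚ ℕtoℚ (size G)
mainTheorem3 _ _ _ k@(suc k-1) I _ _ fI S 0<S A assigned small m 1≤m G C =
  ℚP.*-cancelˡ-≤-pos (ℕtoℚ k) {{ℕtoℚ-suc-positive k-1}} (begin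
    ℕtoℚ k * (ℕtoℚ m * S)                ≡⟨ sym (ℚP.*-assoc (ℕtoℚ k) (ℕtoℚ m) S) ⟩
    ℕtoℚ k * ℕtoℚ m * S                  ≡⟨ cong (_* S) (sym (ℕtoℚ-* k m)) ⟩
    ℕtoℚ (k ℕ.* m) * S                   ≤⟨ ℚP.*-monoʳ-≤-nonNeg S (ℕtoℚ-mono-≤ counted) ⟩
    ℕtoℚ (∑[ v < size G ] ∣ A G v ∣) * S ≤⟨ ∑-bound (λ v → ∣ A G v ∣) S (ℕtoℚ k) (small G m 1≤m C) ⟩
    ℕtoℚ (size G) * ℕtoℚ k               ≡⟨ ℚP.*-comm (ℕtoℚ (size G)) (ℕtoℚ k) ⟩
    ℕtoℚ k * ℕtoℚ (size G)               ∎)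
  where
  open ℚP.≤-Reasoning
  counted : k ℕ.* m ≤ ∑[ v < size G ] ∣ A G v ∣
  counted = total-assignment-≥ C I fI (A G) (assigned G)
  instance
    S-nonNeg : ℚ.NonNegative S
    S-nonNeg = ℚP.pos⇒nonNeg S {{ℚ.positive 0<S}}
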